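{- (Derived Category Theorem.) Let $A$ be a finite alphabet, let $(H_1,V_1)$, $(H_2,V_2)$ be finite forest algebras, and let $\alpha:A^{\Delta}\to (H_1,V_1)$ and $\beta:A^{\Delta}\to(H_2,V_2)$ be surjective forest algebra homomorphisms. Let $(H,V)$ be a finite forest algebra. (a) If $\mathcal{D}_{\alpha,\beta}\prec (H,V)$, then $(H_1,V_1)\prec (H,V)\circ (H_2,V_2)$. (b) Suppose $\alpha=\gamma\delta$, where $\delta:A^{\Delta}\to (H,V)\circ(H_2,V_2)$ is a forest algebra homomorphism and $\gamma:\mathrm{Im}\,\delta\to (H_1,V_1)$ is a forest algebra homomorphism, and suppose $\beta=\pi\delta$, where $\pi$ is the projection of the wreath product onto its right-hand factor. Then $\mathcal{D}_{\alpha,\beta}\prec (H,V)$.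
   Context: Forest algebras. A forest algebra $(H,V)$ consists of a commutative monoid $H$ (written additively, identity $0$), a monoid $V$ (written multiplicatively, identity $1$), and a right action $H\times V\to H$, $(h,v)\mapsto hv$, with $(hv_1)v_2=h(v_1v_2)$, $h1=h$, which is faithful ($hv=hv'$ for all $h\in H$ implies $v=v'$), and such that for all $v\in V$, $h\in H$ there is an element $v+h\in V$ with $g(v+h)=gv+h$ for all $g\in H$. A homomorphism $(H,V)\to(H',V')$ is a pair of monoid homomorphisms (both denoted by the same letter) $H\to H'$, $V\to V'$ with $\alpha(hv)=\alpha(h)\alpha(v)$. $(H,V)\prec(H',V')$ ("divides") means $(H,V)$ is a homomorphic image of a subalgebra of $(H',V')$. Free forest algebra. For a finite alphabet $A$, $A^{\Delta}=(H_A,V_A)$: $H_A$ is the set of finite forests (finite multisets of finite rooted trees with unordered children) with nodes labeled by letters of $A$, with $+$ the disjoint union and $0$ the empty forest; $V_A$ is the set of contexts, i.e. such forests in which exactly one leaf is replaced by a hole $\Box$ (the hole alone is the identity context). For $s\in H_A$, $p,q\in V_A$: $sp$ is obtained by substituting $s$ for the hole of $p$, $pq$ by substituting $p$ for the hole of $q$, and $p+s$ by adding the trees of $s$ to $p$. For $a\in A$, $\Box a$ is the context consisting of a root labeled $a$ whose only child is the hole. Every map $f:A\to V$ into a forest algebra $(H,V)$ extends uniquely to a homomorphism with $\Box a\mapsto f(a)$. Wreath product. $(H,V)\circ(H_2,V_2)=(H\times H_2,\,V^{H_2}\times V_2)$ with componentwise addition on $H\times H_2$, action $(h,h_2)(f,v_2)=(h\cdot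 f(h_2),\,h_2v_2)$, and product $(f_1,v_1)(f_2,v_2)=(g,v_1v_2)$ where $g(h_2)=f_1(h_2)f_2(h_2v_1)$; this is a forest algebra and $\pi$ denotes the projection homomorphism onto the right factor $(H_2,V_2)$. Forest categories. A forest category $\mathcal C$ consists of: a finite set $\mathrm{Obj}(\mathcal C)$ which is a commutative monoid under $+$ with identity $0$; for all objects $x,y$ a set $\mathrm{Arr}(x,y)$ of arrows (pairwise disjoint, with union $\mathrm{Arr}(\mathcal C)$); for each object $x$ a set $\mathrm{HArr}(x)$ of half-arrows to $x$ (pairwise disjoint, with union $\mathrm{HArr}(\mathcal C)$), subject to: (1) $\mathrm{HArr}(\mathcal C)$ is a commutative monoid under $+$ with $\mathrm{HArr}(x)+\mathrm{HArr}(y)\subseteq\mathrm{HArr}(x+y)$, the map sending a half-arrow in $\mathrm{HArr}(x)$ to $x$ being a homomorphism onto $\mathrm{Obj}(\mathcal C)$; (2) an associative composition $\mathrm{Arr}(x,y)\times\mathrm{Arr}(y,z)\to\mathrm{Arr}(x,z)$, $(u,v)\mapsto uv$, with identity arrows $1_x\in\mathrm{Arr}(x,x)$; (3) an action $\mathrm{HArr}(x)\times\mathrm{Arr}(x,y)\to\mathrm{HArr}(y)$, $(c,u)\mapsto cu$, with $(cu)v=c(uv)$ and $c1_x=c$, which is faithful: if $u,u'\in\mathrm{Arr}(x,y)$ and $cu=cu'$ for all $c\in\mathrm{HArr}(x)$ then $u=u'$; (4) for $u\in\mathrm{Arr}(x,y)$ and $c\in\mathrm{HArr}(z)$ an arrow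 $u+c\in\mathrm{Arr}(x,y+z)$ with $f(u+c)=(fu)+c$ for all arrows $f\in\mathrm{Arr}(w,x)$ and $(u+c)+d=u+(c+d)$ for all half-arrows $d$. Division of a forest category by a forest algebra. $\mathcal C\prec(H,V)$ means: there are nonempty sets $K_c\subseteq H$ for each half-arrow $c$ and $K_u\subseteq V$ for each arrow $u$ such that, whenever the operations are defined, $K_uK_v\subseteq K_{uv}$, $K_cK_u\subseteq K_{cu}$, $K_c+K_d\subseteq K_{c+d}$, and $K_u+K_c\subseteq K_{u+c}$ (with $u,v$ arrows, $c,d$ half-arrows); and distinct arrows in the same $\mathrm{Arr}(x,y)$ have disjoint covering sets, and distinct half-arrows in the same $\mathrm{HArr}(y)$ have disjoint covering sets. Derived category $\mathcal D_{\alpha,\beta}$. Objects: $H_2$. Half-arrows to $h\in H_2$: pairs $(\alpha(s),h)$ with $s\in H_A$, $\beta(s)=h$, added componentwise. Arrows from $h$ to $h'$: equivalence classes of triples $(h,p,h')$ with $p\in V_A$ and $h\beta(p)=h'$, where $(h,p,h')\sim(h,q,h')$ iff $\alpha(sp)=\alpha(sq)$ for all $s\in H_A$ with $\beta(s)=h$. Operations: $[h,p,h'][h',q,h'']=[h,pq,h'']$; identity $[h,1,h]$; $(h_1,h_2)[h_2,p,h_2']=(h_1\alpha(p),h_2')$; $[h,p,h']+(\alpha(s),\beta(s))=[h,p+s,h'+\beta(s)]$. This is a forest category. -}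

module Defs where

open import Data.List using (List; []; _∷_; _++_)
open import Data.List.Relation.Binary.Permutation.Homogeneous using (Permutation)
open import Data.Product using (Σ; ∃; _×_; _,_; proj₁; proj₂)
open import Data.Nat using (ℕ)
open import Data.Fin using (Fin)
open import Data.Empty using (⊥)
open import Relation.Nullary using (¬_)
open import Relation.Binary using (IsEquivalence)
open import Relation.Binary.PropositionalEquality using (_≡_)

record IsFinite {X : Set} (_≈_ : X → X → Set) : Set where
  field
    size    : ℕ
    to      : X → Fin size
    from    : Fin size → X
    to-cong : ∀ {x y} → x ≈ y → to x ≡ to y
    to-inj  : ∀ {x y} → to x ≡ to y → x ≈ y
    to-from : ∀ i → to (from i) ≡ i

-- The operations of a (candidate) forest algebra (H,V), on setoid carriers.
--   _⊕_ / 𝟘 : the commutative monoid H,   _⊙_ / 𝟙 : the monoid V,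
--   h ▹ v  : the right action hv,          v ⊞ h  : the element v + h.

record FAStr : Set₁ where
  infixl 6 _⊕_
  infixl 7 _⊙_
  infixl 5 _▹_ _⊞_
  infix 4 _≈ₕ_ _≈ᵥ_
  field
    H V  : Set
    _≈ₕ_ : H → H → Set
    _≈ᵥ_ : V → V → Set
    _⊕_  : H → H → H
    𝟘    : H
    _⊙_  : V → V → V
    𝟙    : V
    _▹_  : H → V → H
    _⊞_  : V → H → V

record IsForestAlgebra (S : FAStr) : Set where
  open FAStr S
  field
    ≈ₕ-equiv    : IsEquivalence _≈ₕ_
    ≈ᵥ-equiv    : IsEquivalence _≈ᵥ_
    ⊕-cong      : ∀ {a b c d} → a ≈ₕ b → c ≈ₕ d → a ⊕ c ≈ₕ b ⊕ d
    ⊙-cong      : ∀ {u v w x} → u ≈ᵥ v → w ≈ᵥ x → u ⊙ w ≈ᵥ v ⊙ x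
    ▹-cong      : ∀ {a b u v} → a ≈ₕ b → u ≈ᵥ v → a ▹ u ≈ₕ b ▹ v
    ⊞-cong      : ∀ {u v a b} → u ≈ᵥ v → a ≈ₕ b → u ⊞ a ≈ᵥ v ⊞ b
    ⊕-assoc     : ∀ a b c → (a ⊕ b) ⊕ c ≈ₕ a ⊕ (b ⊕ c)
    ⊕-comm      : ∀ a b → a ⊕ b ≈ₕ b ⊕ a
    ⊕-identityˡ : ∀ a → 𝟘 ⊕ a ≈ₕ a
    ⊙-assoc     : ∀ u v w → (u ⊙ v) ⊙ w ≈ᵥ u ⊙ (v ⊙ w)
    ⊙-identityˡ : ∀ v → 𝟙 ⊙ v ≈ᵥ v
    ⊙-identityʳ : ∀ v → v ⊙ 𝟙 ≈ᵥ v
    ▹-assoc     : ∀ h u v → (h ▹ u) ▹ v ≈ₕ h ▹ (u ⊙ v)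
    ▹-identity  : ∀ h → h ▹ 𝟙 ≈ₕ h
    faithful    : ∀ {u v} → (∀ h → h ▹ u ≈ₕ h ▹ v) → u ≈ᵥ v
    ⊞-spec      : ∀ v h g → g ▹ (v ⊞ h) ≈ₕ (g ▹ v) ⊕ h

Finite : FAStr → Set
Finite S = IsFinite (FAStr._≈ₕ_ S) × IsFinite (FAStr._≈ᵥ_ S)

-- Forests are lists of trees, considered up to the (recursive) unordered
-- equivalence _≅ᶠ_ (i.e. finite multisets of unordered trees).
-- A context is  ctx f t : the forest f together with the tree t containing
-- the hole (t = hole, or a node labelled a whose children form a context).

data Tree (A : Set) : Set where
  node : A → List (Tree A) → Tree A

Forest : Set → Set
Forest A = List (Tree A)

data CTree (A : Set) : Set
data Context (A : Set) : Set where
  ctx : Forest A → CTree A → Context A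
data CTree A where
  hole  : CTree A
  cnode : A → Context A → CTree A

module _ {A : Set} where

  data _≅ᵗ_ : Tree A → Tree A → Set where
    node : ∀ {a f g} → Permutation _≅ᵗ_ f g → node a f ≅ᵗ node a g

  _≅ᶠ_ : Forest A → Forest A → Set
  _≅ᶠ_ = Permutation _≅ᵗ_

  data _≅ᶜ_ : Context A → Context A → Set
  data _≅ᶜᵗ_ : CTree A → CTree A → Set
  data _≅ᶜ_ where
    ctx : ∀ {f g t u} → f ≅ᶠ g → t ≅ᶜᵗ u → ctx f t ≅ᶜ ctx g u
  data _≅ᶜᵗ_ where
    hole  : hole ≅ᶜᵗ hole
    cnode : ∀ {a p q} → p ≅ᶜ q → cnode a p ≅ᶜᵗ cnode a q

  plug : Forest A → Context A → Forest A
  plug s (ctx f hole)        = s ++ f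
  plug s (ctx f (cnode a p)) = node a (plug s p) ∷ f

  addC : Context A → Forest A → Context A
  addC (ctx f t) g = ctx (f ++ g) t

  comp : Context A → Context A → Context A
  comp p (ctx f hole)        = addC p f
  comp p (ctx f (cnode a q)) = ctx f (cnode a (comp p q))

  □ : Context A
  □ = ctx [] hole

  letter : A → Context A
  letter a = ctx [] (cnode a □)

Free : Set → FAStr
Free A = record
  { H = Forest A ; V = Context A
  ; _≈ₕ_ = _≅ᶠ_ ; _≈ᵥ_ = _≅ᶜ_
  ; _⊕_ = _++_ ; 𝟘 = []
  ; _⊙_ = comp ; 𝟙 = □
  ; _▹_ = plug ; _⊞_ = addC }

record Hom (S T : FAStr) : Set where
  private
    module S = FAStr S
    module T = FAStr T
  field
    onH    : S.H → T.H
    onV    : S.V → T.V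
    onH-cong : ∀ {x y} → x S.≈ₕ y → onH x T.≈ₕ onH y
    onV-cong : ∀ {u v} → u S.≈ᵥ v → onV u T.≈ᵥ onV v
    onH-⊕  : ∀ x y → onH (x S.⊕ y) T.≈ₕ onH x T.⊕ onH y
    onH-𝟘  : onH S.𝟘 T.≈ₕ T.𝟘
    onV-⊙  : ∀ u v → onV (u S.⊙ v) T.≈ᵥ onV u T.⊙ onV v
    onV-𝟙  : onV S.𝟙 T.≈ᵥ T.𝟙
    on-▹   : ∀ x v → onH (x S.▹ v) T.≈ₕ onH x T.▹ onV v

Surjective : ∀ {S T} → Hom S T → Set
Surjective {S} {T} φ =
  (∀ y → ∃ λ x → Hom.onH φ x ≈ₕ y) × (∀ w → ∃ λ v → Hom.onV φ v ≈ᵥ w)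
  where open FAStr T

record SubHom (S T : FAStr) (PH : FAStr.H S → Set) (PV : FAStr.V S → Set) : Set where
  private
    module S = FAStr S
    module T = FAStr T
  field
    onH : ∀ x → PH x → T.H
    onV : ∀ v → PV v → T.V
    onH-cong : ∀ {x y} (px : PH x) (py : PH y) → x S.≈ₕ y → onH x px T.≈ₕ onH y py
    onV-cong : ∀ {u v} (pu : PV u) (pv : PV v) → u S.≈ᵥ v → onV u pu T.≈ᵥ onV v pv
    onH-⊕ : ∀ {x y} (px : PH x) (py : PH y) (pxy : PH (x S.⊕ y)) →
            onH (x S.⊕ y) pxy T.≈ₕ onH x px T.⊕ onH y py
    onH-𝟘 : (p : PH S.𝟘) → onH S.𝟘 p T.≈ₕ T.𝟘
    onV-⊙ : ∀ {u v} (pu : PV u) (pv : PV v) (puv : PV (u S.⊙ v)) →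
            onV (u S.⊙ v) puv T.≈ᵥ onV u pu T.⊙ onV v pv
    onV-𝟙 : (p : PV S.𝟙) → onV S.𝟙 p T.≈ᵥ T.𝟙
    on-▹  : ∀ {x v} (px : PH x) (pv : PV v) (pxv : PH (x S.▹ v)) →
            onH (x S.▹ v) pxv T.≈ₕ onH x px T.▹ onV v pv

record Divides (S T : FAStr) : Set₁ where
  private
    module S = FAStr S
    module T = FAStr T
  field
    PH : T.H → Set
    PV : T.V → Set
    𝟘-closed : PH T.𝟘
    ⊕-closed : ∀ {x y} → PH x → PH y → PH (x T.⊕ y)
    𝟙-closed : PV T.𝟙
    ⊙-closed : ∀ {u v} → PV u → PV v → PV (u T.⊙ v)
    ▹-closed : ∀ {x v} → PH x → PV v → PH (x T.▹ v)
    ⊞-closed : ∀ {v x} → PV v → PH x → PV (v T.⊞ x)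
    φ : SubHom T S PH PV
    φ-surjH : ∀ y → Σ T.H λ x → Σ (PH x) λ px → SubHom.onH φ x px S.≈ₕ y
    φ-surjV : ∀ w → Σ T.V λ v → Σ (PV v) λ pv → SubHom.onV φ v pv S.≈ᵥ w

module _ (S : FAStr) (isS : IsForestAlgebra S) (S₂ : FAStr) (isS₂ : IsForestAlgebra S₂) where
  private
    module S  = FAStr S
    module S₂ = FAStr S₂
    module I  = IsForestAlgebra isS
    module I₂ = IsForestAlgebra isS₂

  CongMap : Set
  CongMap = Σ (S₂.H → S.V) λ f → ∀ {a b} → a S₂.≈ₕ b → f a S.≈ᵥ f b

  Wreath : FAStr
  Wreath = record
    { H = S.H × S₂.H
    ; V = CongMap × S₂.V
    ; _≈ₕ_ = λ x y → (proj₁ x S.≈ₕ proj₁ y) × (proj₂ x S₂.≈ₕ proj₂ y)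
    ; _≈ᵥ_ = λ u v → (∀ k → proj₁ (proj₁ u) k S.≈ᵥ proj₁ (proj₁ v) k)
                     × (proj₂ u S₂.≈ᵥ proj₂ v)
    ; _⊕_ = λ x y → (proj₁ x S.⊕ proj₁ y) , (proj₂ x S₂.⊕ proj₂ y)
    ; 𝟘 = S.𝟘 , S₂.𝟘
    ; _⊙_ = λ { ((f₁ , c₁) , v₁) ((f₂ , c₂) , v₂) →
                ((λ k → f₁ k S.⊙ f₂ (k S₂.▹ v₁)) ,
                 (λ e → I.⊙-cong (c₁ e) (c₂ (I₂.▹-cong e (IsEquivalence.refl I₂.≈ᵥ-equiv))))) ,
                (v₁ S₂.⊙ v₂) }
    ; 𝟙 = ((λ _ → S.𝟙) , (λ _ → IsEquivalence.refl I.≈ᵥ-equiv)) , S₂.𝟙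
    ; _▹_ = λ { (h , h₂) ((f , _) , v₂) → (h S.▹ f h₂) , (h₂ S₂.▹ v₂) }
    ; _⊞_ = λ { ((f , c) , v₂) (h , h₂) →
                ((λ k → f k S.⊞ h) , (λ e → I.⊞-cong (c e) (IsEquivalence.refl I.≈ₕ-equiv))) ,
                (v₂ S₂.⊞ h₂) }
    }

module _ {A : Set} {W : FAStr} (δ : Hom (Free A) W) where
  private module W = FAStr W
  ImH : W.H → Set
  ImH x = ∃ λ s → Hom.onH δ s W.≈ₕ x
  ImV : W.V → Set
  ImV v = ∃ λ p → Hom.onV δ p W.≈ᵥ v

-- The derived category D_{α,β} and its division by a forest algebra T,
-- written out explicitly.
--   objects     : elements of H₂
--   half-arrows : pairs (x , h) ∈ H₁ × H₂ with x = α s, h = β s for some s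
--   arrows      : classes of triples (h , p , h') with h β(p) = h', where
--                 (h,p,h') ~ (g,q,g') iff h = g, h' = g' and
--                 α(sp) = α(sq) for all forests s with β s = h.
-- Covering sets are given as predicates KH x h ⊆ H_T (for half-arrow (x,h))
-- and KA h p h' ⊆ V_T (for the arrow [h,p,h']); they are subsets of the
-- setoid carriers (closed under ≈) and depend only on the half-arrow/arrow.

module _ {A : Set} {S₁ S₂ : FAStr} (α : Hom (Free A) S₁) (β : Hom (Free A) S₂) where
  private
    module S₁ = FAStr S₁
    module S₂ = FAStr S₂
    module F  = FAStr (Free A)
    αH = Hom.onH α
    αV = Hom.onV α
    βH = Hom.onH β
    βV = Hom.onV β

  IsHalfArrow : S₁.H → S₂.H → Set
  IsHalfArrow x h = ∃ λ s → (αH s S₁.≈ₕ x) × (βH s S₂.≈ₕ h)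

  IsArrow : S₂.H → Context A → S₂.H → Set
  IsArrow h p h' = h S₂.▹ βV p S₂.≈ₕ h'

  SameArrow : S₂.H → Context A → S₂.H → S₂.H → Context A → S₂.H → Set
  SameArrow h p h' g q g' =
    (h S₂.≈ₕ g) × (h' S₂.≈ₕ g') ×
    (∀ s → βH s S₂.≈ₕ h → αH (s F.▹ p) S₁.≈ₕ αH (s F.▹ q))

  record DerivedDivides (T : FAStr) : Set₁ where
    private module T = FAStr T
    field
      KH : S₁.H → S₂.H → T.H → Set
      KA : S₂.H → Context A → S₂.H → T.V → Set
      KH-closed : ∀ {x h k k'} → k T.≈ₕ k' → KH x h k → KH x h k'
      KA-closed : ∀ {h p h' k k'} → k T.≈ᵥ k' → KA h p h' k → KA h p h' k'
      KH-wd : ∀ {x h x' h' k} → x S₁.≈ₕ x' → h S₂.≈ₕ h' → KH x h k → KH x' h' k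
      KA-wd : ∀ {h p h' g q g' k} → IsArrow h p h' → IsArrow g q g' →
              SameArrow h p h' g q g' → KA h p h' k → KA g q g' k
      KH-nonempty : ∀ {x h} → IsHalfArrow x h → ∃ λ k → KH x h k
      KA-nonempty : ∀ {h p h'} → IsArrow h p h' → ∃ λ k → KA h p h' k
      K-comp : ∀ {h p h' q h'' k k'} → IsArrow h p h' → IsArrow h' q h'' →
               KA h p h' k → KA h' q h'' k' → KA h (p F.⊙ q) h'' (k T.⊙ k')
      -- K_c K_u ⊆ K_{cu},  (x , h)[h , p , h'] = (x α(p) , h')
      K-act : ∀ {x h p h' k k'} → IsHalfArrow x h → IsArrow h p h' →
              KH x h k → KA h p h' k' → KH (x S₁.▹ αV p) h' (k T.▹ k')
      K-add : ∀ {x h y g k k'} → IsHalfArrow x h → IsHalfArrow y g →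
              KH x h k → KH y g k' → KH (x S₁.⊕ y) (h S₂.⊕ g) (k T.⊕ k')
      -- K_u + K_c ⊆ K_{u+c},  [h,p,h'] + (α s , β s) = [h , p+s , h'+β s]
      K-addA : ∀ {h p h' s k k'} → IsArrow h p h' →
               KA h p h' k → KH (αH s) (βH s) k' →
               KA h (p F.⊞ s) (h' S₂.⊕ βH s) (k T.⊞ k')
      KA-disj : ∀ {h p q h' k} → IsArrow h p h' → IsArrow h q h' →
                ¬ SameArrow h p h' h q h' → KA h p h' k → KA h q h' k → ⊥
      KH-disj : ∀ {x y h k} → IsHalfArrow x h → IsHalfArrow y h →
                ¬ (x S₁.≈ₕ y) → KH x h k → KH y h k → ⊥

-- (a) Choose a cover k₀ of the empty half-arrow and, for every letter a and object h, a cover of the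
-- arrow [h, □a, h β(□a)] (depending only on the class of h, by finiteness of H₂). Sending □a to
-- (h ↦ (□ + k₀) · cover, β(□a)) extends to δ : A^Δ → (H,V) ∘ (H₂,V₂) with πδ = β, and by induction
-- on forests  δ₁ s + k₀  covers the half-arrow (α s, β s). Disjointness of the covers of half-arrows
-- gives: δ s = δ t implies α s = α t, so (H₁,V₁) is a quotient of the image of δ.
-- (b) Cover the half-arrow (x, h) by the first components of δ s over the forests s with α s = x and
-- β s = h, and the arrow [h, p, h′] by the k whose action carries covers of any (x, h) to covers of
-- (x α(p), h′). Since α = γδ, the value α s is determined by δ s, which makes these covers disjoint.

module Submission where

open import Defs
open import Data.Product using (Σ; ∃; _×_; _,_; proj₁; proj₂)
open import Data.List using ([]; _∷_; _++_)
open import Data.List.Properties using (++-assoc; ++-identityʳ)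
open import Data.List.Relation.Binary.Permutation.Homogeneous using (refl; prep; swap; trans)
open import Data.List.Relation.Binary.Pointwise.Base using (Pointwise; []; _∷_)
open import Data.Fin.Properties using () renaming (_≟_ to _≟ᶠ_)
open import Relation.Nullary using (yes; no)
open import Relation.Nullary.Decidable using (decidable-stable)
open import Relation.Binary using (Setoid; IsEquivalence; Decidable)
open import Relation.Binary.PropositionalEquality as ≡ using (_≡_)
import Relation.Binary.Reasoning.Setoid as SetoidReasoning

module ForestAlgebraProperties (S : FAStr) (isS : IsForestAlgebra S) where
  open FAStr S public
  open IsForestAlgebra isS public

  open IsEquivalence ≈ₕ-equiv public using ()
    renaming (refl to reflₕ; sym to symₕ; trans to transₕ; reflexive to reflexiveₕ)
  open IsEquivalence ≈ᵥ-equiv public using ()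
    renaming (refl to reflᵥ; sym to symᵥ; trans to transᵥ; reflexive to reflexiveᵥ)

  setoidₕ : Setoid _ _
  setoidₕ = record { isEquivalence = ≈ₕ-equiv }

  setoidᵥ : Setoid _ _
  setoidᵥ = record { isEquivalence = ≈ᵥ-equiv }

  module ≈ₕ-Reasoning = SetoidReasoning setoidₕ
  module ≈ᵥ-Reasoning = SetoidReasoning setoidᵥ

  ⊕-identityʳ : ∀ a → a ⊕ 𝟘 ≈ₕ a
  ⊕-identityʳ a = transₕ (⊕-comm a 𝟘) (⊕-identityˡ a)

  ▹-𝟙⊞ : ∀ h x → h ▹ (𝟙 ⊞ x) ≈ₕ h ⊕ x
  ▹-𝟙⊞ h x = transₕ (⊞-spec 𝟙 x h) (⊕-cong (▹-identity h) reflₕ)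

  ⊙-𝟙⊞ : ∀ v x → v ⊙ (𝟙 ⊞ x) ≈ᵥ v ⊞ x
  ⊙-𝟙⊞ v x = faithful λ g → begin
    g ▹ (v ⊙ (𝟙 ⊞ x))  ≈⟨ ▹-assoc g v (𝟙 ⊞ x) ⟨
    (g ▹ v) ▹ (𝟙 ⊞ x)  ≈⟨ ▹-𝟙⊞ (g ▹ v) x ⟩
    (g ▹ v) ⊕ x        ≈⟨ ⊞-spec v x g ⟨
    g ▹ (v ⊞ x)        ∎
    where open ≈ₕ-Reasoning

  ⊞-⊕ : ∀ v x y → (v ⊞ x) ⊞ y ≈ᵥ v ⊞ (x ⊕ y)
  ⊞-⊕ v x y = faithful λ g → begin
    g ▹ ((v ⊞ x) ⊞ y)  ≈⟨ ⊞-spec (v ⊞ x) y g ⟩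
    (g ▹ (v ⊞ x)) ⊕ y  ≈⟨ ⊕-cong (⊞-spec v x g) reflₕ ⟩
    ((g ▹ v) ⊕ x) ⊕ y  ≈⟨ ⊕-assoc (g ▹ v) x y ⟩
    (g ▹ v) ⊕ (x ⊕ y)  ≈⟨ ⊞-spec v (x ⊕ y) g ⟨
    g ▹ (v ⊞ (x ⊕ y))  ∎
    where open ≈ₕ-Reasoning

  ⊙-⊞ : ∀ u v x → (u ⊙ v) ⊞ x ≈ᵥ u ⊙ (v ⊞ x)
  ⊙-⊞ u v x = faithful λ g → begin
    g ▹ ((u ⊙ v) ⊞ x)  ≈⟨ ⊞-spec (u ⊙ v) x g ⟩
    (g ▹ (u ⊙ v)) ⊕ x  ≈⟨ ⊕-cong (▹-assoc g u v) reflₕ ⟨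
    ((g ▹ u) ▹ v) ⊕ x  ≈⟨ ⊞-spec v x (g ▹ u) ⟨
    (g ▹ u) ▹ (v ⊞ x)  ≈⟨ ▹-assoc g u (v ⊞ x) ⟩
    g ▹ (u ⊙ (v ⊞ x))  ∎
    where open ≈ₕ-Reasoning

  x⊕yz≈y⊕xz : ∀ x y z → x ⊕ (y ⊕ z) ≈ₕ y ⊕ (x ⊕ z)
  x⊕yz≈y⊕xz x y z = begin
    x ⊕ (y ⊕ z)  ≈⟨ ⊕-assoc x y z ⟨
    (x ⊕ y) ⊕ z  ≈⟨ ⊕-cong (⊕-comm x y) reflₕ ⟩
    (y ⊕ x) ⊕ z  ≈⟨ ⊕-assoc y x z ⟩
    y ⊕ (x ⊕ z)  ∎
    where open ≈ₕ-Reasoning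

  ⊞-identityʳ : ∀ v → v ⊞ 𝟘 ≈ᵥ v
  ⊞-identityʳ v = faithful λ g → transₕ (⊞-spec v 𝟘 g) (⊕-identityʳ (g ▹ v))

IsFinite⇒decidable : ∀ {X : Set} {_≈_ : X → X → Set} → IsFinite _≈_ → Decidable _≈_
IsFinite⇒decidable fin x y with IsFinite.to fin x ≟ᶠ IsFinite.to fin y
... | yes eq = yes (IsFinite.to-inj fin eq)
... | no neq = no λ x≈y → neq (IsFinite.to-cong fin x≈y)

IsFinite⇒congruentChoice : ∀ {X Y : Set} {_≈_ : X → X → Set} → IsFinite _≈_ →
  (P : X → Y → Set) → (∀ {x x′ y} → x ≈ x′ → P x y → P x′ y) → (∀ x → ∃ (P x)) →
  Σ (X → Y) λ f → (∀ x → P x (f x)) × (∀ {x x′} → x ≈ x′ → f x ≡ f x′)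
IsFinite⇒congruentChoice {X} {Y} fin P P-resp witness =
  choice , (λ x → P-resp (to-inj (to-from (to x))) (proj₂ (witness (from (to x))))) ,
  λ x≈x′ → ≡.cong (λ i → proj₁ (witness (from i))) (to-cong x≈x′)
  where
  open IsFinite fin
  choice : X → Y
  choice x = proj₁ (witness (from (to x)))

module WreathProduct (T : FAStr) (isT : IsForestAlgebra T) (S₂ : FAStr) (isS₂ : IsForestAlgebra S₂) where
  private
    module T  = ForestAlgebraProperties T isT
    module S₂ = ForestAlgebraProperties S₂ isS₂
    W : FAStr
    W = Wreath T isT S₂ isS₂

  wreath-isForestAlgebra : IsForestAlgebra W
  wreath-isForestAlgebra = record
    { ≈ₕ-equiv = record
      { refl  = T.reflₕ , S₂.reflₕ
      ; sym   = λ (e , e₂) → T.symₕ e , S₂.symₕ e₂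
      ; trans = λ (e , e₂) (d , d₂) → T.transₕ e d , S₂.transₕ e₂ d₂
      }
    ; ≈ᵥ-equiv = record
      { refl  = (λ _ → T.reflᵥ) , S₂.reflᵥ
      ; sym   = λ (e , e₂) → (λ k → T.symᵥ (e k)) , S₂.symᵥ e₂
      ; trans = λ (e , e₂) (d , d₂) → (λ k → T.transᵥ (e k) (d k)) , S₂.transᵥ e₂ d₂
      }
    ; ⊕-cong = λ (e , e₂) (d , d₂) → T.⊕-cong e d , S₂.⊕-cong e₂ d₂
    ; ⊙-cong = λ { {w = (_ , w-cong) , _} (e , e₂) (d , d₂) →
        (λ k → T.⊙-cong (e k) (T.transᵥ (w-cong (S₂.▹-cong S₂.reflₕ e₂)) (d _))) ,
        S₂.⊙-cong e₂ d₂ }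
    ; ▹-cong = λ { {u = (_ , u-cong) , _} (e , e₂) (d , d₂) →
        T.▹-cong e (T.transᵥ (u-cong e₂) (d _)) , S₂.▹-cong e₂ d₂ }
    ; ⊞-cong = λ (e , e₂) (d , d₂) → (λ k → T.⊞-cong (e k) d) , S₂.⊞-cong e₂ d₂
    ; ⊕-assoc = λ a b c → T.⊕-assoc _ _ _ , S₂.⊕-assoc _ _ _
    ; ⊕-comm = λ a b → T.⊕-comm _ _ , S₂.⊕-comm _ _
    ; ⊕-identityˡ = λ a → T.⊕-identityˡ _ , S₂.⊕-identityˡ _
    ; ⊙-assoc = λ { u v ((_ , w-cong) , _) →
        (λ k → T.transᵥ (T.⊙-assoc _ _ _)
                 (T.⊙-cong T.reflᵥ (T.⊙-cong T.reflᵥ (w-cong (S₂.symₕ (S₂.▹-assoc _ _ _)))))) ,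
        S₂.⊙-assoc _ _ _ }
    ; ⊙-identityˡ = λ { ((_ , v-cong) , _) →
        (λ k → T.transᵥ (T.⊙-identityˡ _) (v-cong (S₂.▹-identity k))) , S₂.⊙-identityˡ _ }
    ; ⊙-identityʳ = λ v → (λ k → T.⊙-identityʳ _) , S₂.⊙-identityʳ _
    ; ▹-assoc = λ h u v → T.▹-assoc _ _ _ , S₂.▹-assoc _ _ _
    ; ▹-identity = λ h → T.▹-identity _ , S₂.▹-identity _
    ; faithful = λ same →
        (λ k → T.faithful λ h → proj₁ (same (h , k))) ,
        S₂.faithful λ h₂ → proj₂ (same (T.𝟘 , h₂))
    ; ⊞-spec = λ v h g → T.⊞-spec _ _ _ , S₂.⊞-spec _ _ _
    }

  wreath-projection : Hom W S₂
  wreath-projection = record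
    { onH = proj₂ ; onV = proj₂
    ; onH-cong = proj₂ ; onV-cong = proj₂
    ; onH-⊕ = λ _ _ → S₂.reflₕ ; onH-𝟘 = S₂.reflₕ
    ; onV-⊙ = λ _ _ → S₂.reflᵥ ; onV-𝟙 = S₂.reflᵥ
    ; on-▹ = λ _ _ → S₂.reflₕ
    }

plug-letter : ∀ {A : Set} (f : Forest A) a → plug f (letter a) ≡ node a f ∷ []
plug-letter f a = ≡.cong (λ g → node a g ∷ []) (++-identityʳ f)

onH-node : ∀ {A : Set} {S : FAStr} → IsForestAlgebra S → (φ : Hom (Free A) S) →
  ∀ a f → FAStr._≈ₕ_ S (Hom.onH φ (node a f ∷ [])) (FAStr._▹_ S (Hom.onH φ f) (Hom.onV φ (letter a)))
onH-node {S = S} isS φ a f =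
  transₕ (reflexiveₕ (≡.cong onH (≡.sym (plug-letter f a)))) (on-▹ f (letter a))
  where
  open ForestAlgebraProperties S isS
  open Hom φ

plug-addC : ∀ {A : Set} (s : Forest A) p t → plug s (addC p t) ≡ plug s p ++ t
plug-addC s (ctx f hole)        t = ≡.sym (++-assoc s f t)
plug-addC s (ctx f (cnode a p)) t = ≡.refl

onV-⊞ : ∀ {A : Set} {S : FAStr} → IsForestAlgebra S → (φ : Hom (Free A) S) →
  (∀ y → ∃ λ s → FAStr._≈ₕ_ S (Hom.onH φ s) y) →
  ∀ p s → FAStr._≈ᵥ_ S (Hom.onV φ (addC p s)) (FAStr._⊞_ S (Hom.onV φ p) (Hom.onH φ s))
onV-⊞ {S = S} isS φ φ-surjective p s = faithful λ g →
  let (t , φt≈g) = φ-surjective g in begin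
    g ▹ onV (addC p s)        ≈⟨ ▹-cong φt≈g reflᵥ ⟨
    onH t ▹ onV (addC p s)    ≈⟨ on-▹ t (addC p s) ⟨
    onH (plug t (addC p s))   ≡⟨ ≡.cong onH (plug-addC t p s) ⟩
    onH (plug t p ++ s)       ≈⟨ onH-⊕ (plug t p) s ⟩
    onH (plug t p) ⊕ onH s    ≈⟨ ⊕-cong (on-▹ t p) reflₕ ⟩
    (onH t ▹ onV p) ⊕ onH s   ≈⟨ ⊕-cong (▹-cong φt≈g reflᵥ) reflₕ ⟩
    (g ▹ onV p) ⊕ onH s       ≈⟨ ⊞-spec (onV p) (onH s) g ⟨
    g ▹ (onV p ⊞ onH s)       ∎
  where
  open ForestAlgebraProperties S isS
  open Hom φ
  open ≈ₕ-Reasoning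

module FreeExtension {A : Set} (W : FAStr) (isW : IsForestAlgebra W) (ℓ : A → FAStr.V W) where
  open ForestAlgebraProperties W isW

  extendH : Forest A → H
  extendT : Tree A → H
  extendH []      = 𝟘
  extendH (t ∷ f) = extendT t ⊕ extendH f
  extendT (node a f) = extendH f ▹ ℓ a

  extendV : Context A → V
  extendC : CTree A → V
  extendV (ctx f t)   = extendC t ⊞ extendH f
  extendC hole        = 𝟙
  extendC (cnode a p) = extendV p ⊙ ℓ a

  extendH-cong : ∀ {f g} → f ≅ᶠ g → extendH f ≈ₕ extendH g
  extendH-pointwise : ∀ {f g} → Pointwise _≅ᵗ_ f g → extendH f ≈ₕ extendH g
  extendT-cong : ∀ {t u} → t ≅ᵗ u → extendT t ≈ₕ extendT u
  extendH-cong (refl f≋g)       = extendH-pointwise f≋g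
  extendH-cong (prep t≅u f≅g)   = ⊕-cong (extendT-cong t≅u) (extendH-cong f≅g)
  extendH-cong (swap t≅t′ u≅u′ f≅g) =
    transₕ (⊕-cong (extendT-cong t≅t′) (⊕-cong (extendT-cong u≅u′) (extendH-cong f≅g)))
           (x⊕yz≈y⊕xz _ _ _)
  extendH-cong (trans f≅g g≅h)  = transₕ (extendH-cong f≅g) (extendH-cong g≅h)
  extendH-pointwise []            = reflₕ
  extendH-pointwise (t≅u ∷ f≋g)   = ⊕-cong (extendT-cong t≅u) (extendH-pointwise f≋g)
  extendT-cong (node f≅g) = ▹-cong (extendH-cong f≅g) reflᵥ

  extendV-cong : ∀ {p q} → p ≅ᶜ q → extendV p ≈ᵥ extendV q
  extendC-cong : ∀ {t u} → t ≅ᶜᵗ u → extendC t ≈ᵥ extendC u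
  extendV-cong (ctx f≅g t≅u) = ⊞-cong (extendC-cong t≅u) (extendH-cong f≅g)
  extendC-cong hole          = reflᵥ
  extendC-cong (cnode p≅q)   = ⊙-cong (extendV-cong p≅q) reflᵥ

  extendH-++ : ∀ s t → extendH (s ++ t) ≈ₕ extendH s ⊕ extendH t
  extendH-++ []      t = symₕ (⊕-identityˡ (extendH t))
  extendH-++ (x ∷ s) t = transₕ (⊕-cong reflₕ (extendH-++ s t)) (symₕ (⊕-assoc _ _ _))

  extendH-plug : ∀ s p → extendH (plug s p) ≈ₕ extendH s ▹ extendV p
  extendH-plug s (ctx f hole) = transₕ (extendH-++ s f) (symₕ (▹-𝟙⊞ (extendH s) (extendH f)))
  extendH-plug s (ctx f (cnode a q)) = begin
    (extendH (plug s q) ▹ ℓ a) ⊕ extendH f          ≈⟨ ⊕-cong (▹-cong (extendH-plug s q) reflᵥ) reflₕ ⟩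
    ((extendH s ▹ extendV q) ▹ ℓ a) ⊕ extendH f     ≈⟨ ⊕-cong (▹-assoc _ _ _) reflₕ ⟩
    (extendH s ▹ (extendV q ⊙ ℓ a)) ⊕ extendH f     ≈⟨ ⊞-spec _ _ _ ⟨
    extendH s ▹ ((extendV q ⊙ ℓ a) ⊞ extendH f)     ∎
    where open ≈ₕ-Reasoning

  extendV-addC : ∀ p s → extendV (addC p s) ≈ᵥ extendV p ⊞ extendH s
  extendV-addC (ctx f t) s = transᵥ (⊞-cong reflᵥ (extendH-++ f s)) (symᵥ (⊞-⊕ _ _ _))

  extendV-comp : ∀ p q → extendV (comp p q) ≈ᵥ extendV p ⊙ extendV q
  extendV-comp p (ctx f hole) = transᵥ (extendV-addC p f) (symᵥ (⊙-𝟙⊞ (extendV p) (extendH f)))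
  extendV-comp p (ctx f (cnode a q)) = begin
    (extendV (comp p q) ⊙ ℓ a) ⊞ extendH f          ≈⟨ ⊞-cong (⊙-cong (extendV-comp p q) reflᵥ) reflₕ ⟩
    ((extendV p ⊙ extendV q) ⊙ ℓ a) ⊞ extendH f     ≈⟨ ⊞-cong (⊙-assoc _ _ _) reflₕ ⟩
    (extendV p ⊙ (extendV q ⊙ ℓ a)) ⊞ extendH f     ≈⟨ ⊙-⊞ _ _ _ ⟩
    extendV p ⊙ ((extendV q ⊙ ℓ a) ⊞ extendH f)     ∎
    where open ≈ᵥ-Reasoning

  extend : Hom (Free A) W
  extend = record
    { onH = extendH ; onV = extendV
    ; onH-cong = extendH-cong ; onV-cong = extendV-cong
    ; onH-⊕ = extendH-++ ; onH-𝟘 = reflₕ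
    ; onV-⊙ = extendV-comp ; onV-𝟙 = ⊞-identityʳ 𝟙
    ; on-▹ = extendH-plug
    }

  extend-letter : ∀ a → extendV (letter a) ≈ᵥ ℓ a
  extend-letter a = begin
    ((𝟙 ⊞ 𝟘) ⊙ ℓ a) ⊞ 𝟘  ≈⟨ ⊞-identityʳ _ ⟩
    (𝟙 ⊞ 𝟘) ⊙ ℓ a        ≈⟨ ⊙-cong (⊞-identityʳ 𝟙) reflᵥ ⟩
    𝟙 ⊙ ℓ a              ≈⟨ ⊙-identityˡ (ℓ a) ⟩
    ℓ a                  ∎
    where open ≈ᵥ-Reasoning

  module _ {S : FAStr} (isS : IsForestAlgebra S) (φ : Hom (Free A) S) (ψ : Hom W S)
           (agree : ∀ a → FAStr._≈ᵥ_ S (Hom.onV ψ (ℓ a)) (Hom.onV φ (letter a))) where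
    private
      module S = ForestAlgebraProperties S isS
      module φ = Hom φ
      module ψ = Hom ψ

    extend-unique : ∀ s → ψ.onH (extendH s) S.≈ₕ φ.onH s
    extend-uniqueT : ∀ t → ψ.onH (extendT t) S.≈ₕ φ.onH (t ∷ [])
    extend-unique [] = S.transₕ ψ.onH-𝟘 (S.symₕ φ.onH-𝟘)
    extend-unique (t ∷ f) = begin
      ψ.onH (extendT t ⊕ extendH f)              ≈⟨ ψ.onH-⊕ _ _ ⟩
      ψ.onH (extendT t) S.⊕ ψ.onH (extendH f)    ≈⟨ S.⊕-cong (extend-uniqueT t) (extend-unique f) ⟩
      φ.onH (t ∷ []) S.⊕ φ.onH f                 ≈⟨ φ.onH-⊕ (t ∷ []) f ⟨
      φ.onH (t ∷ f)                              ∎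
      where open S.≈ₕ-Reasoning
    extend-uniqueT (node a f) = begin
      ψ.onH (extendH f ▹ ℓ a)                    ≈⟨ ψ.on-▹ _ _ ⟩
      ψ.onH (extendH f) S.▹ ψ.onV (ℓ a)          ≈⟨ S.▹-cong (extend-unique f) (agree a) ⟩
      φ.onH f S.▹ φ.onV (letter a)               ≈⟨ onH-node isS φ a f ⟨
      φ.onH (node a f ∷ [])                      ∎
      where open S.≈ₕ-Reasoning

-- The image of δ is a subalgebra of W, mapped onto S by  δ s ↦ α s.  Hom does not ask for
-- preservation of ⊞, hence the hypothesis δ-⊞.
module ImageDivision {A : Set} {S W : FAStr} (isS : IsForestAlgebra S) (isW : IsForestAlgebra W)
  (α : Hom (Free A) S) (α-surjective : Surjective α) (δ : Hom (Free A) W)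
  (δ-⊞ : ∀ p s → FAStr._≈ᵥ_ W (Hom.onV δ (addC p s)) (FAStr._⊞_ W (Hom.onV δ p) (Hom.onH δ s)))
  (δ-reflects : ∀ s t → FAStr._≈ₕ_ W (Hom.onH δ s) (Hom.onH δ t) →
                       FAStr._≈ₕ_ S (Hom.onH α s) (Hom.onH α t))
  where
  private
    module S = ForestAlgebraProperties S isS
    module W = ForestAlgebraProperties W isW
    module α = Hom α
    module δ = Hom δ

  ⊕-image : ∀ {s t x y} → δ.onH s W.≈ₕ x → δ.onH t W.≈ₕ y → δ.onH (s ++ t) W.≈ₕ x W.⊕ y
  ⊕-image {s} {t} e e′ = W.transₕ (δ.onH-⊕ s t) (W.⊕-cong e e′)

  ▹-image : ∀ {s p x v} → δ.onH s W.≈ₕ x → δ.onV p W.≈ᵥ v → δ.onH (plug s p) W.≈ₕ x W.▹ v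
  ▹-image {s} {p} e e′ = W.transₕ (δ.on-▹ s p) (W.▹-cong e e′)

  ⊙-image : ∀ {p q u v} → δ.onV p W.≈ᵥ u → δ.onV q W.≈ᵥ v → δ.onV (comp p q) W.≈ᵥ u W.⊙ v
  ⊙-image {p} {q} e e′ = W.transᵥ (δ.onV-⊙ p q) (W.⊙-cong e e′)

  ⊞-image : ∀ {p s v x} → δ.onV p W.≈ᵥ v → δ.onH s W.≈ₕ x → δ.onV (addC p s) W.≈ᵥ v W.⊞ x
  ⊞-image {p} {s} e e′ = W.transᵥ (δ-⊞ p s) (W.⊞-cong e e′)

  α-wdₕ : ∀ {s t x} → δ.onH s W.≈ₕ x → δ.onH t W.≈ₕ x → α.onH s S.≈ₕ α.onH t
  α-wdₕ {s} {t} e e′ = δ-reflects s t (W.transₕ e (W.symₕ e′))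

  α-wdᵥ : ∀ {p q v} → δ.onV p W.≈ᵥ v → δ.onV q W.≈ᵥ v → α.onV p S.≈ᵥ α.onV q
  α-wdᵥ {p} {q} e e′ = S.faithful λ x →
    let (s , αs≈x) = proj₁ α-surjective x in begin
      x S.▹ α.onV p             ≈⟨ S.▹-cong αs≈x S.reflᵥ ⟨
      α.onH s S.▹ α.onV p       ≈⟨ α.on-▹ s p ⟨
      α.onH (plug s p)          ≈⟨ α-wdₕ (▹-image W.reflₕ e) (▹-image W.reflₕ e′) ⟩
      α.onH (plug s q)          ≈⟨ α.on-▹ s q ⟩
      α.onH s S.▹ α.onV q       ≈⟨ S.▹-cong αs≈x S.reflᵥ ⟩
      x S.▹ α.onV q             ∎
    where open S.≈ₕ-Reasoning

  factor : SubHom W S (ImH δ) (ImV δ)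
  factor = record
    { onH = λ _ (s , _) → α.onH s
    ; onV = λ _ (p , _) → α.onV p
    ; onH-cong = λ (s , e) (t , e′) x≈y → α-wdₕ (W.transₕ e x≈y) e′
    ; onV-cong = λ (p , e) (q , e′) u≈v → α-wdᵥ (W.transᵥ e u≈v) e′
    ; onH-⊕ = λ { (s , e) (t , e′) (u , e″) → S.transₕ (α-wdₕ e″ (⊕-image e e′)) (α.onH-⊕ s t) }
    ; onH-𝟘 = λ (u , e) → S.transₕ (α-wdₕ e δ.onH-𝟘) α.onH-𝟘
    ; onV-⊙ = λ { (p , e) (q , e′) (r , e″) → S.transᵥ (α-wdᵥ e″ (⊙-image e e′)) (α.onV-⊙ p q) }
    ; onV-𝟙 = λ (r , e) → S.transᵥ (α-wdᵥ e δ.onV-𝟙) α.onV-𝟙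
    ; on-▹ = λ { (s , e) (p , e′) (t , e″) → S.transₕ (α-wdₕ e″ (▹-image e e′)) (α.on-▹ s p) }
    }

  divides : Divides S W
  divides = record
    { PH = ImH δ ; PV = ImV δ
    ; 𝟘-closed = [] , δ.onH-𝟘
    ; ⊕-closed = λ (s , e) (t , e′) → s ++ t , ⊕-image e e′
    ; 𝟙-closed = □ , δ.onV-𝟙
    ; ⊙-closed = λ (p , e) (q , e′) → comp p q , ⊙-image e e′
    ; ▹-closed = λ (s , e) (p , e′) → plug s p , ▹-image e e′
    ; ⊞-closed = λ (p , e) (s , e′) → addC p s , ⊞-image e e′
    ; φ = factor
    ; φ-surjH = λ y → let (s , e) = proj₁ α-surjective y in δ.onH s , (s , W.reflₕ) , e
    ; φ-surjV = λ w → let (p , e) = proj₂ α-surjective w in δ.onV p , (p , W.reflᵥ) , e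
    }

module DerivedDivisionToWreath {A : Set} {S₁ S₂ T : FAStr}
  (isS₁ : IsForestAlgebra S₁) (isS₂ : IsForestAlgebra S₂) (isT : IsForestAlgebra T)
  (fin₁ : Finite S₁) (fin₂ : Finite S₂)
  (α : Hom (Free A) S₁) (β : Hom (Free A) S₂) (α-surjective : Surjective α)
  (D : DerivedDivides α β T)
  where
  private
    module S₁ = ForestAlgebraProperties S₁ isS₁
    module S₂ = ForestAlgebraProperties S₂ isS₂
    module T  = ForestAlgebraProperties T isT
    module α = Hom α
    module β = Hom β
    W : FAStr
    W = Wreath T isT S₂ isS₂
    module W = FAStr W
  open DerivedDivides D
  open WreathProduct T isT S₂ isS₂

  halfArrow : ∀ s → IsHalfArrow α β (α.onH s) (β.onH s)
  halfArrow s = s , S₁.reflₕ , S₂.reflₕ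

  k₀ : T.H
  k₀ = proj₁ (KH-nonempty (halfArrow []))

  k₀-covers : KH (α.onH []) (β.onH []) k₀
  k₀-covers = proj₂ (KH-nonempty (halfArrow []))

  private
    letterChoice : (a : A) → Σ (S₂.H → T.V) λ c →
      (∀ h → KA h (letter a) (h S₂.▹ β.onV (letter a)) (c h)) × (∀ {h h′} → h S₂.≈ₕ h′ → c h ≡ c h′)
    letterChoice a = IsFinite⇒congruentChoice (proj₁ fin₂)
      (λ h → KA h (letter a) (h S₂.▹ β.onV (letter a)))
      (λ h≈h′ → KA-wd S₂.reflₕ S₂.reflₕ (h≈h′ , S₂.▹-cong h≈h′ S₂.reflᵥ , λ _ _ → S₁.reflₕ))
      (λ h → KA-nonempty S₂.reflₕ)

  letterCover : A → S₂.H → T.V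
  letterCover a = proj₁ (letterChoice a)

  letterCover-covers : ∀ a h → KA h (letter a) (h S₂.▹ β.onV (letter a)) (letterCover a h)
  letterCover-covers a = proj₁ (proj₂ (letterChoice a))

  letterCover-cong : ∀ a {h h′} → h S₂.≈ₕ h′ → letterCover a h ≡ letterCover a h′
  letterCover-cong a = proj₂ (proj₂ (letterChoice a))

  -- 𝟘 need not cover the empty forest, so every letter first adds k₀ to the forest below it.
  ℓ : A → W.V
  ℓ a = ((λ h → (T.𝟙 T.⊞ k₀) T.⊙ letterCover a h) ,
         λ h≈h′ → T.⊙-cong T.reflᵥ (T.reflexiveᵥ (letterCover-cong a h≈h′))) ,
        β.onV (letter a)

  open FreeExtension W wreath-isForestAlgebra ℓ
  private module δ = Hom extend

  δ₁ : Forest A → T.H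
  δ₁ s = proj₁ (δ.onH s)

  δ₂≈β : ∀ s → proj₂ (δ.onH s) S₂.≈ₕ β.onH s
  δ₂≈β = extend-unique isS₂ β wreath-projection λ _ → S₂.reflᵥ

  δ₁⊕k₀-covers : ∀ s → KH (α.onH s) (β.onH s) (δ₁ s T.⊕ k₀)
  δ₁-covers-tree : ∀ t → KH (α.onH (t ∷ [])) (β.onH (t ∷ [])) (δ₁ (t ∷ []))
  δ₁⊕k₀-covers [] = KH-closed (T.symₕ (T.⊕-identityˡ k₀)) k₀-covers
  δ₁⊕k₀-covers (t ∷ f) =
    KH-wd (S₁.symₕ (α.onH-⊕ (t ∷ []) f)) (S₂.symₕ (β.onH-⊕ (t ∷ []) f))
      (KH-closed (T.symₕ δ₁-split)
        (K-add (halfArrow (t ∷ [])) (halfArrow f) (δ₁-covers-tree t) (δ₁⊕k₀-covers f)))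
    where
    δ₁-split : δ₁ (t ∷ f) T.⊕ k₀ T.≈ₕ δ₁ (t ∷ []) T.⊕ (δ₁ f T.⊕ k₀)
    δ₁-split = T.transₕ (T.⊕-cong (proj₁ (δ.onH-⊕ (t ∷ []) f)) T.reflₕ) (T.⊕-assoc _ _ _)
  δ₁-covers-tree (node a f) =
    KH-wd (S₁.symₕ (onH-node isS₁ α a f)) (S₂.symₕ (onH-node isS₂ β a f))
      (KH-closed (T.symₕ δ₁-node)
        (K-act (halfArrow f) S₂.reflₕ (δ₁⊕k₀-covers f) (letterCover-covers a (β.onH f))))
    where
    δ₁-node : δ₁ (node a f ∷ []) T.≈ₕ (δ₁ f T.⊕ k₀) T.▹ letterCover a (β.onH f)
    δ₁-node = begin
      δ₁ (node a f ∷ [])                          ≈⟨ proj₁ (onH-node wreath-isForestAlgebra extend a f) ⟩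
      δ₁ f T.▹ proj₁ (proj₁ (extendV (letter a))) (proj₂ (δ.onH f))
                                                  ≈⟨ T.▹-cong T.reflₕ (proj₁ (extend-letter a) _) ⟩
      δ₁ f T.▹ ((T.𝟙 T.⊞ k₀) T.⊙ letterCover a (proj₂ (δ.onH f)))
                                                  ≈⟨ T.▹-assoc _ _ _ ⟨
      (δ₁ f T.▹ (T.𝟙 T.⊞ k₀)) T.▹ letterCover a (proj₂ (δ.onH f))
                                                  ≈⟨ T.▹-cong (T.▹-𝟙⊞ _ _) T.reflᵥ ⟩
      (δ₁ f T.⊕ k₀) T.▹ letterCover a (proj₂ (δ.onH f))
                                                  ≡⟨ ≡.cong ((δ₁ f T.⊕ k₀) T.▹_) (letterCover-cong a (δ₂≈β f)) ⟩
      (δ₁ f T.⊕ k₀) T.▹ letterCover a (β.onH f)   ∎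
      where open T.≈ₕ-Reasoning

  -- KH-disj only yields ¬¬ (α s ≈ α t); decidability of ≈ on the finite H₁ removes the double negation.
  δ-reflects : ∀ s t → δ.onH s W.≈ₕ δ.onH t → α.onH s S₁.≈ₕ α.onH t
  δ-reflects s t (δ₁s≈δ₁t , δ₂s≈δ₂t) =
    decidable-stable (IsFinite⇒decidable (proj₁ fin₁) _ _) λ αs≉αt →
      KH-disj (halfArrow s) (t , S₁.reflₕ , S₂.symₕ βs≈βt) αs≉αt (δ₁⊕k₀-covers s)
        (KH-wd S₁.reflₕ (S₂.symₕ βs≈βt)
          (KH-closed (T.⊕-cong (T.symₕ δ₁s≈δ₁t) T.reflₕ) (δ₁⊕k₀-covers t)))
    where
    βs≈βt : β.onH s S₂.≈ₕ β.onH t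
    βs≈βt = S₂.transₕ (S₂.symₕ (δ₂≈β s)) (S₂.transₕ δ₂s≈δ₂t (δ₂≈β t))

  divides : Divides S₁ W
  divides = ImageDivision.divides isS₁ wreath-isForestAlgebra α α-surjective extend extendV-addC δ-reflects

module WreathToDerivedDivision {A : Set} {S₁ S₂ T : FAStr}
  (isS₁ : IsForestAlgebra S₁) (isS₂ : IsForestAlgebra S₂) (isT : IsForestAlgebra T)
  (α : Hom (Free A) S₁) (β : Hom (Free A) S₂) (α-surjective : Surjective α) (β-surjective : Surjective β)
  (δ : Hom (Free A) (Wreath T isT S₂ isS₂))
  (γ : SubHom (Wreath T isT S₂ isS₂) S₁ (ImH δ) (ImV δ))
  (α≈γδ : ∀ s (m : ImH δ (Hom.onH δ s)) →
            FAStr._≈ₕ_ S₁ (Hom.onH α s) (SubHom.onH γ (Hom.onH δ s) m))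
  (β≈πδ : ∀ s → FAStr._≈ₕ_ S₂ (Hom.onH β s) (proj₂ (Hom.onH δ s)))
  where
  private
    module S₁ = ForestAlgebraProperties S₁ isS₁
    module S₂ = ForestAlgebraProperties S₂ isS₂
    module T  = ForestAlgebraProperties T isT
    module α = Hom α
    module β = Hom β
    module δ = Hom δ
    module γ = SubHom γ

  δ₁ : Forest A → T.H
  δ₁ s = proj₁ (δ.onH s)

  δ-context : Context A → S₂.H → T.V
  δ-context p = proj₁ (proj₁ (δ.onV p))

  δ-context-cong : ∀ p {h h′} → h S₂.≈ₕ h′ → δ-context p h T.≈ᵥ δ-context p h′
  δ-context-cong p = proj₂ (proj₁ (δ.onV p))

  δ₁-plug : ∀ s p → δ₁ (plug s p) T.≈ₕ δ₁ s T.▹ δ-context p (β.onH s)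
  δ₁-plug s p = T.transₕ (proj₁ (δ.on-▹ s p)) (T.▹-cong T.reflₕ (δ-context-cong p (S₂.symₕ (β≈πδ s))))

  inImage : ∀ s → ImH δ (δ.onH s)
  inImage s = s , T.reflₕ , S₂.reflₕ

  α-determined : ∀ s t → δ₁ s T.≈ₕ δ₁ t → β.onH s S₂.≈ₕ β.onH t → α.onH s S₁.≈ₕ α.onH t
  α-determined s t δ₁s≈δ₁t βs≈βt = begin
    α.onH s                        ≈⟨ α≈γδ s (inImage s) ⟩
    γ.onH (δ.onH s) (inImage s)    ≈⟨ γ.onH-cong (inImage s) (inImage t) (δ₁s≈δ₁t , δ₂s≈δ₂t) ⟩
    γ.onH (δ.onH t) (inImage t)    ≈⟨ α≈γδ t (inImage t) ⟨
    α.onH t                        ∎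
    where
    open S₁.≈ₕ-Reasoning
    δ₂s≈δ₂t : proj₂ (δ.onH s) S₂.≈ₕ proj₂ (δ.onH t)
    δ₂s≈δ₂t = S₂.transₕ (S₂.symₕ (β≈πδ s)) (S₂.transₕ βs≈βt (β≈πδ t))

  KH : S₁.H → S₂.H → T.H → Set
  KH x h k = ∃ λ s → (α.onH s S₁.≈ₕ x) × (β.onH s S₂.≈ₕ h) × (δ₁ s T.≈ₕ k)

  KA : S₂.H → Context A → S₂.H → T.V → Set
  KA h p h′ k = IsArrow α β h p h′ × (∀ {x k₁} → KH x h k₁ → KH (x S₁.▹ α.onV p) h′ (k₁ T.▹ k))

  KH-functional : ∀ {x y h k} → KH x h k → KH y h k → x S₁.≈ₕ y
  KH-functional (s , αs≈x , βs≈h , δ₁s≈k) (t , αt≈y , βt≈h , δ₁t≈k) =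
    S₁.transₕ (S₁.symₕ αs≈x)
      (S₁.transₕ (α-determined s t (T.transₕ δ₁s≈k (T.symₕ δ₁t≈k)) (S₂.transₕ βs≈h (S₂.symₕ βt≈h)))
                 αt≈y)

  KH-add : ∀ {x h k y g k′} → KH x h k → KH y g k′ → KH (x S₁.⊕ y) (h S₂.⊕ g) (k T.⊕ k′)
  KH-add (s , αs≈x , βs≈h , δ₁s≈k) (t , αt≈y , βt≈g , δ₁t≈k′) =
    s ++ t , S₁.transₕ (α.onH-⊕ s t) (S₁.⊕-cong αs≈x αt≈y) ,
    S₂.transₕ (β.onH-⊕ s t) (S₂.⊕-cong βs≈h βt≈g) ,
    T.transₕ (proj₁ (δ.onH-⊕ s t)) (T.⊕-cong δ₁s≈k δ₁t≈k′)

  δ-context-covers : ∀ {h p h′} → IsArrow α β h p h′ → KA h p h′ (δ-context p h)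
  δ-context-covers {h} {p} hβp≈h′ = hβp≈h′ , λ (s , αs≈x , βs≈h , δ₁s≈k) →
    plug s p ,
    S₁.transₕ (α.on-▹ s p) (S₁.▹-cong αs≈x S₁.reflᵥ) ,
    S₂.transₕ (β.on-▹ s p) (S₂.transₕ (S₂.▹-cong βs≈h S₂.reflᵥ) hβp≈h′) ,
    T.transₕ (δ₁-plug s p) (T.▹-cong δ₁s≈k (δ-context-cong p βs≈h))

  KH-resp : ∀ {x x′ h h′ k k′} → x S₁.≈ₕ x′ → h S₂.≈ₕ h′ → k T.≈ₕ k′ → KH x h k → KH x′ h′ k′
  KH-resp x≈x′ h≈h′ k≈k′ (s , αs≈x , βs≈h , δ₁s≈k) =
    s , S₁.transₕ αs≈x x≈x′ , S₂.transₕ βs≈h h≈h′ , T.transₕ δ₁s≈k k≈k′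

  KA-resp-SameArrow : ∀ {h p h′ g q g′ k} → IsArrow α β g q g′ →
    SameArrow α β h p h′ g q g′ → KA h p h′ k → KA g q g′ k
  KA-resp-SameArrow {p = p} {q = q} gβq≈g′ (h≈g , h′≈g′ , same) (_ , act) = gβq≈g′ ,
    λ { {x} (s , αs≈x , βs≈g , δ₁s≈k₁) →
      let βs≈h = S₂.transₕ βs≈g (S₂.symₕ h≈g)
          xαp≈xαq : x S₁.▹ α.onV p S₁.≈ₕ x S₁.▹ α.onV q
          xαp≈xαq = begin
            x S₁.▹ α.onV p         ≈⟨ S₁.▹-cong αs≈x S₁.reflᵥ ⟨
            α.onH s S₁.▹ α.onV p   ≈⟨ α.on-▹ s p ⟨
            α.onH (plug s p)       ≈⟨ same s βs≈h ⟩
            α.onH (plug s q)       ≈⟨ α.on-▹ s q ⟩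
            α.onH s S₁.▹ α.onV q   ≈⟨ S₁.▹-cong αs≈x S₁.reflᵥ ⟩
            x S₁.▹ α.onV q         ∎
      in KH-resp xαp≈xαq h′≈g′ T.reflₕ (act (s , αs≈x , βs≈h , δ₁s≈k₁)) }
    where open S₁.≈ₕ-Reasoning

  KA-comp : ∀ {h p h′ q h″ k k′} → IsArrow α β h p h′ → IsArrow α β h′ q h″ →
    KA h p h′ k → KA h′ q h″ k′ → KA h (comp p q) h″ (k T.⊙ k′)
  KA-comp {h} {p} {h′} {q} {h″} hβp≈h′ h′βq≈h″ (_ , act) (_ , act′) = arrow ,
    λ c → KH-resp (S₁.transₕ (S₁.▹-assoc _ _ _) (S₁.▹-cong S₁.reflₕ (S₁.symᵥ (α.onV-⊙ p q))))
                  S₂.reflₕ (T.▹-assoc _ _ _) (act′ (act c))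
    where
    open S₂.≈ₕ-Reasoning
    arrow : IsArrow α β h (comp p q) h″
    arrow = begin
      h S₂.▹ β.onV (comp p q)            ≈⟨ S₂.▹-cong S₂.reflₕ (β.onV-⊙ p q) ⟩
      h S₂.▹ (β.onV p S₂.⊙ β.onV q)      ≈⟨ S₂.▹-assoc h _ _ ⟨
      (h S₂.▹ β.onV p) S₂.▹ β.onV q      ≈⟨ S₂.▹-cong hβp≈h′ S₂.reflᵥ ⟩
      h′ S₂.▹ β.onV q                    ≈⟨ h′βq≈h″ ⟩
      h″                                 ∎

  KA-addC : ∀ {h p h′ s k k′} → IsArrow α β h p h′ → KA h p h′ k → KH (α.onH s) (β.onH s) k′ →
    KA h (addC p s) (h′ S₂.⊕ β.onH s) (k T.⊞ k′)
  KA-addC {h} {p} {h′} {s} {k} {k′} hβp≈h′ (_ , act) covers-s = arrow ,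
    λ {x} {k₁} c → KH-resp (xαp⊕αs x) S₂.reflₕ (T.symₕ (T.⊞-spec k k′ k₁)) (KH-add (act c) covers-s)
    where
    arrow : IsArrow α β h (addC p s) (h′ S₂.⊕ β.onH s)
    arrow = S₂.transₕ (S₂.▹-cong S₂.reflₕ (onV-⊞ isS₂ β (proj₁ β-surjective) p s))
              (S₂.transₕ (S₂.⊞-spec _ _ h) (S₂.⊕-cong hβp≈h′ S₂.reflₕ))
    xαp⊕αs : ∀ x → (x S₁.▹ α.onV p) S₁.⊕ α.onH s S₁.≈ₕ x S₁.▹ α.onV (addC p s)
    xαp⊕αs x = S₁.transₕ (S₁.symₕ (S₁.⊞-spec _ _ x))
                 (S₁.▹-cong S₁.reflₕ (S₁.symᵥ (onV-⊞ isS₁ α (proj₁ α-surjective) p s)))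

  KA-functional : ∀ {h p q h′ k} → KA h p h′ k → KA h q h′ k → SameArrow α β h p h′ h q h′
  KA-functional {p = p} {q} (_ , act) (_ , act′) = S₂.reflₕ , S₂.reflₕ , λ s βs≈h →
    let covers-s = s , S₁.reflₕ , βs≈h , T.reflₕ in begin
      α.onH (plug s p)       ≈⟨ α.on-▹ s p ⟩
      α.onH s S₁.▹ α.onV p   ≈⟨ KH-functional (act covers-s) (act′ covers-s) ⟩
      α.onH s S₁.▹ α.onV q   ≈⟨ α.on-▹ s q ⟨
      α.onH (plug s q)       ∎
    where open S₁.≈ₕ-Reasoning

  derivedDivides : DerivedDivides α β T
  derivedDivides = record
    { KH = KH
    ; KA = KA
    ; KH-closed = KH-resp S₁.reflₕ S₂.reflₕ
    ; KA-closed = λ k≈k′ (arrow , act) →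
        arrow , λ c → KH-resp S₁.reflₕ S₂.reflₕ (T.▹-cong T.reflₕ k≈k′) (act c)
    ; KH-wd = λ x≈x′ h≈h′ → KH-resp x≈x′ h≈h′ T.reflₕ
    ; KA-wd = λ _ → KA-resp-SameArrow
    ; KH-nonempty = λ (s , αs≈x , βs≈h) → δ₁ s , s , αs≈x , βs≈h , T.reflₕ
    ; KA-nonempty = λ arrow → _ , δ-context-covers arrow
    ; K-comp = KA-comp
    ; K-act = λ _ _ c (_ , act) → act c
    ; K-add = λ _ _ → KH-add
    ; K-addA = KA-addC
    ; KA-disj = λ _ _ different a b → different (KA-functional a b)
    ; KH-disj = λ _ _ x≉y c d → x≉y (KH-functional c d)
    }

theorem1 : (A : Set) → IsFinite (_≡_ {A = A}) →
  (S₁ S₂ T : FAStr) →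
  (isS₁ : IsForestAlgebra S₁) (isS₂ : IsForestAlgebra S₂) (isT : IsForestAlgebra T) →
  Finite S₁ → Finite S₂ → Finite T →
  (α : Hom (Free A) S₁) (β : Hom (Free A) S₂) →
  Surjective α → Surjective β →
  (DerivedDivides α β T → Divides S₁ (Wreath T isT S₂ isS₂))
  × ((δ : Hom (Free A) (Wreath T isT S₂ isS₂)) →
     (γ : SubHom (Wreath T isT S₂ isS₂) S₁ (ImH δ) (ImV δ)) →
     (∀ s (m : ImH δ (Hom.onH δ s)) →
        FAStr._≈ₕ_ S₁ (Hom.onH α s) (SubHom.onH γ (Hom.onH δ s) m)) →
     (∀ p (m : ImV δ (Hom.onV δ p)) →
        FAStr._≈ᵥ_ S₁ (Hom.onV α p) (SubHom.onV γ (Hom.onV δ p) m)) →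
     (∀ s → FAStr._≈ₕ_ S₂ (Hom.onH β s) (proj₂ (Hom.onH δ s))) →
     (∀ p → FAStr._≈ᵥ_ S₂ (Hom.onV β p) (proj₂ (Hom.onV δ p))) →
     DerivedDivides α β T)
theorem1 A _ S₁ S₂ T isS₁ isS₂ isT fin₁ fin₂ _ α β α-surjective β-surjective =
  DerivedDivisionToWreath.divides isS₁ isS₂ isT fin₁ fin₂ α β α-surjective ,
  λ δ γ α≈γδ _ β≈πδ _ →
    WreathToDerivedDivision.derivedDivides isS₁ isS₂ isT α β α-surjective β-surjective δ γ α≈γδ β≈πδ
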